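{- For every $n\ge1$, every $1\le i\le m$ and every $s\in\mathcal{S}_n$, $|N_n^1(s)\cap B_n^i|=1$ if $s\in B_n^i$ and $|N_n^1(s)\cap B_n^i|=n$ if $s\notin B_n^i$.
   Context: $\Sigma=\{c_1,\ldots,c_m\}$ is a finite alphabet with $m=|\Sigma|>1$, $\mathcal{S}_n=\Sigma^n$ with the edit (Levenshtein) distance $\mathrm{edit}$. $N_n^1(s)=\{t\in\mathcal{S}_n:\mathrm{edit}(s,t)\le 1\}$. Define recursively $B_1^i=\{c_i\}$ for $1\le i\le m$, and for $n\ge2$, $B_n^i=\bigcup_{j=1}^m c_j\circ B_{n-1}^{((i+j-2)\bmod m)+1}$, where $c\circ X$ denotes the set obtained by prepending the character $c$ to each sequence of $X$ (so $c_1$ is paired with $B_{n-1}^i$, $c_2$ with $B_{n-1}^{i+1}$, and so on cyclically). -}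

module Defs where

open import Data.Nat using (ℕ; zero; suc; _+_; _⊔_; _⊓_)
open import Data.Nat.DivMod using (_mod_)
open import Data.Fin using (Fin; toℕ)
open import Data.List using (List; []; _∷_; length; map; concatMap; filter; [_])
open import Data.List.Relation.Unary.Any using (any?)
open import Data.Vec using (Vec; toList) renaming ([] to []ᵥ; _∷_ to _∷ᵥ_)
open import Data.Vec.Properties using (≡-dec)
open import Data.Product using (_×_)
open import Relation.Nullary using (Dec; yes; no; _×-dec_)
open import Relation.Binary.PropositionalEquality using (_≡_)
open import Data.Nat using (_≤_; _≤?_)
open import Data.Fin using () renaming (_≟_ to _≟F_)

-- Alphabet Σ = Fin m (character c_{k+1} is the Fin element k).
-- Sequences of length n: Vec (Fin m) n.

lev : {m : ℕ} → List (Fin m) → List (Fin m) → ℕ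
lev [] ys = length ys
lev (x ∷ xs) [] = length (x ∷ xs)
lev (x ∷ xs) (y ∷ ys) =
  suc (lev xs (y ∷ ys)) ⊓ (suc (lev (x ∷ xs) ys) ⊓ (lev xs ys + cost (x ≟F y)))
  where
  cost : {A : Set} → Dec A → ℕ
  cost (yes _) = 0
  cost (no _) = 1

edit : {m n : ℕ} → Vec (Fin m) n → Vec (Fin m) n → ℕ
edit s t = lev (toList s) (toList t)

-- All sequences of length n over Fin m (the set S_n), without repetitions.
allSeqs : (m n : ℕ) → List (Vec (Fin m) n)
allSeqs m zero = [ []ᵥ ]
allSeqs m (suc n) = concatMap (λ c → map (c ∷ᵥ_) (allSeqs m n)) (Data.List.allFin m)
  where import Data.List

-- cyclic index shift: for 0-based i, j this is (i + j) mod m, i.e. the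
-- 1-based index ((i+j-2) mod m) + 1 of the paper.
shift : {m : ℕ} → Fin m → Fin m → Fin m
shift {suc k} i j = (toℕ i + toℕ j) mod (suc k)

-- B n i is the paper's B_{n+1}^{i+1} (as a list of sequences of length n+1).
-- B_1^i = {c_i};  B_n^i = ⋃_j c_j ∘ B_{n-1}^{((i+j-2) mod m)+1}.
B : {m : ℕ} → (n : ℕ) → Fin m → List (Vec (Fin m) (suc n))
B zero i = [ i ∷ᵥ []ᵥ ]
B {m} (suc n) i = concatMap (λ j → map (j ∷ᵥ_) (B n (shift i j))) (Data.List.allFin m)
  where import Data.List

_∈S_ : {m n : ℕ} → Vec (Fin m) n → List (Vec (Fin m) n) → Set
s ∈S X = Data.List.Relation.Unary.Any.Any (s ≡_) X
  where import Data.List.Relation.Unary.Any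

_∈S?_ : {m n : ℕ} → (s : Vec (Fin m) n) → (X : List (Vec (Fin m) n)) → Dec (s ∈S X)
s ∈S? X = any? (λ t → ≡-dec _≟F_ s t) X

countN1∩ : {m n : ℕ} → Vec (Fin m) n → List (Vec (Fin m) n) → ℕ
countN1∩ {m} {n} s X =
  length (filter (λ t → (edit s t ≤? 1) ×-dec (t ∈S? X)) (allSeqs m n))

{-# OPTIONS --safe #-}
-- For sequences of equal length, edit distance at most 1 is Hamming distance at most 1.
-- Reading the recursion for B backwards, t ∈ B_n^i exactly when block t = i, where
-- block (c ∷ t) = block t − c (mod m): the B_n^i partition S_n. Count the neighbours of
-- a ∷ s in B^i by their first letter c. For c = a they are the a ∷ t with t a neighbour
-- of s in B^{i+a}; for c ≠ a the only candidate is c ∷ s, and it lies in B^i for exactly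
-- one c, namely the one with i + c = block s. If a ∷ s ∈ B^i that c is a itself, so
-- induction gives 1 neighbour; otherwise it gives n neighbours from c = a plus one more.
module Submission where

open import Defs
open import Data.Nat using (ℕ; zero; suc; _+_; _∸_; _⊓_; _≤_; _<_; _≤?_; z≤n; s≤s; NonZero)
open import Data.Nat.Properties
  using (+-comm; +-assoc; +-identityʳ; m+[n∸m]≡n; m∸n+n≡m; <⇒≤; ≤-trans; ≤-reflexive;
         m⊓n≤n; ⊓-glb; ≰⇒>; 1+n≰n; 1+n≢n; n≤0⇒n≡0; n≢0⇒n>0; +-cancelʳ-≤)
open import Data.Nat.DivMod using (_%_; _mod_; %-distribˡ-+; m%n%n≡m%n; [m+n]%n≡m%n; m<n⇒m%n≡m; m%n<n)
open import Data.Nat.ListAction using (sum)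
open import Data.Fin using (Fin; zero; suc; toℕ) renaming (_≟_ to _≟F_)
open import Data.Fin.Properties using (toℕ-fromℕ<; toℕ-injective; toℕ<n) renaming (suc-injective to Fin-suc-injective)
open import Data.List using (List; []; _∷_; [_]; _++_; length; map; filter; concatMap; tabulate; allFin)
open import Data.List.Properties using (filter-≐; filter-++; filter-none; filter-accept; length-++; map-cong; map-tabulate)
open import Data.List.Relation.Unary.All using (universal)
open import Data.List.Relation.Unary.Any using (here; there; satisfied)
open import Data.List.Membership.Propositional using (lose)
open import Data.List.Membership.Propositional.Properties using (∈-concatMap⁺; ∈-concatMap⁻; ∈-map⁺; ∈-map⁻; ∈-allFin)
open import Data.Vec using (Vec; toList) renaming ([] to []ᵥ; _∷_ to _∷ᵥ_)
open import Data.Vec.Properties using (≡-dec; ∷-injectiveˡ; ∷-injectiveʳ; toList-injective; length-toList)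
open import Data.Vec.Relation.Binary.Equality.Cast using (cast-is-id)
open import Data.Product using (_×_; _,_)
open import Data.Sum using (_⊎_; inj₁; inj₂)
open import Data.Unit using (⊤; tt)
open import Function using (_∘_; _⇔_; mk⇔; Equivalence)
import Function.Properties.Equivalence as ⇔
open import Level using (Level)
open import Relation.Nullary using (¬_; Dec; yes; no; ¬?; contradiction; _×-dec_; _⊎-dec_)
open import Relation.Unary using (Pred; Decidable; _≐_)
open import Relation.Binary.PropositionalEquality using (_≡_; _≢_; refl; sym; trans; cong; cong₂; module ≡-Reasoning)

open Equivalence using (to; from)

private
  variable
    ℓ ℓ′ : Level
    A A′ : Set ℓ′
    k m n : ℕ

count : {P : Pred A ℓ} → Decidable P → List A → ℕ
count P? xs = length (filter P? xs)

module _ {P : Pred A ℓ} (P? : Decidable P) where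

  count-≐ : {Q : Pred A ℓ} (Q? : Decidable Q) → P ≐ Q → ∀ xs → count P? xs ≡ count Q? xs
  count-≐ Q? P≐Q xs = cong length (filter-≐ P? Q? P≐Q xs)

  count-none : (∀ x → ¬ P x) → ∀ xs → count P? xs ≡ 0
  count-none ¬P xs = cong length (filter-none P? (universal ¬P xs))

  count-singleton : ∀ {x} → P x → count P? [ x ] ≡ 1
  count-singleton Px = cong length (filter-accept P? Px)

  count-++ : ∀ xs ys → count P? (xs ++ ys) ≡ count P? xs + count P? ys
  count-++ xs ys = trans (cong length (filter-++ P? xs ys)) (length-++ (filter P? xs))

  count-concatMap : (f : A′ → List A) → ∀ xs → count P? (concatMap f xs) ≡ sum (map (count P? ∘ f) xs)
  count-concatMap f [] = refl
  count-concatMap f (x ∷ xs) = trans (count-++ (f x) (concatMap f xs)) (cong (count P? (f x) +_) (count-concatMap f xs))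

  count-map : (f : A′ → A) → ∀ xs → count P? (map f xs) ≡ count (P? ∘ f) xs
  count-map f [] = refl
  count-map f (x ∷ xs) with P? (f x)
  ... | yes _ = cong suc (count-map f xs)
  ... | no _ = count-map f xs

sum-tabulate-zero : (f : Fin n → ℕ) → (∀ c → f c ≡ 0) → sum (tabulate f) ≡ 0
sum-tabulate-zero {zero} f f≡0 = refl
sum-tabulate-zero {suc n} f f≡0 = cong₂ _+_ (f≡0 zero) (sum-tabulate-zero (f ∘ suc) (f≡0 ∘ suc))

sum-tabulate-point : (f : Fin n → ℕ) (a : Fin n) → (∀ c → c ≢ a → f c ≡ 0) → sum (tabulate f) ≡ f a
sum-tabulate-point f zero f≡0 = trans (cong (f zero +_) (sum-tabulate-zero (f ∘ suc) λ c → f≡0 (suc c) λ ()))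
                                      (+-identityʳ (f zero))
sum-tabulate-point f (suc a) f≡0 =
  cong₂ _+_ (f≡0 zero λ ()) (sum-tabulate-point (f ∘ suc) a λ c c≢a → f≡0 (suc c) (c≢a ∘ Fin-suc-injective))

sum-tabulate-twoPoints : (f : Fin n → ℕ) {a b : Fin n} → a ≢ b → (∀ c → c ≢ a → c ≢ b → f c ≡ 0) →
                         sum (tabulate f) ≡ f a + f b
sum-tabulate-twoPoints f {zero} {zero} a≢b f≡0 = contradiction refl a≢b
sum-tabulate-twoPoints f {zero} {suc b} a≢b f≡0 =
  cong (f zero +_) (sum-tabulate-point (f ∘ suc) b λ c c≢b → f≡0 (suc c) (λ ()) (c≢b ∘ Fin-suc-injective))
sum-tabulate-twoPoints f {suc a} {zero} a≢b f≡0 =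
  trans (cong (f zero +_) (sum-tabulate-point (f ∘ suc) a λ c c≢a → f≡0 (suc c) (c≢a ∘ Fin-suc-injective) (λ ())))
        (+-comm (f zero) (f (suc a)))
sum-tabulate-twoPoints f {suc a} {suc b} a≢b f≡0 =
  cong₂ _+_ (f≡0 zero (λ ()) (λ ()))
            (sum-tabulate-twoPoints (f ∘ suc) (a≢b ∘ cong suc) λ c c≢a c≢b →
              f≡0 (suc c) (c≢a ∘ Fin-suc-injective) (c≢b ∘ Fin-suc-injective))

count-allSeqs-∷ : {P : Pred (Vec (Fin m) (suc n)) ℓ} (P? : Decidable P) →
                  count P? (allSeqs m (suc n)) ≡ sum (tabulate λ c → count (P? ∘ (c ∷ᵥ_)) (allSeqs m n))
count-allSeqs-∷ {m} {n} P? = begin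
  count P? (concatMap (λ c → map (c ∷ᵥ_) (allSeqs m n)) (allFin m))
    ≡⟨ count-concatMap P? (λ c → map (c ∷ᵥ_) (allSeqs m n)) (allFin m) ⟩
  sum (map (λ c → count P? (map (c ∷ᵥ_) (allSeqs m n))) (allFin m))
    ≡⟨ cong sum (map-cong (λ c → count-map P? (c ∷ᵥ_) (allSeqs m n)) (allFin m)) ⟩
  sum (map (λ c → count (P? ∘ (c ∷ᵥ_)) (allSeqs m n)) (allFin m))
    ≡⟨ cong sum (map-tabulate {n = m} (λ c → c) (λ c → count (P? ∘ (c ∷ᵥ_)) (allSeqs m n))) ⟩
  sum (tabulate λ c → count (P? ∘ (c ∷ᵥ_)) (allSeqs m n))
    ∎
  where open ≡-Reasoning

count-allSeqs-≡ : (u : Vec (Fin m) n) → count (λ t → ≡-dec _≟F_ t u) (allSeqs m n) ≡ 1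
count-allSeqs-≡ []ᵥ = refl
count-allSeqs-≡ {m} {suc n} (a ∷ᵥ u) = begin
  count (λ t → ≡-dec _≟F_ t (a ∷ᵥ u)) (allSeqs m (suc n))  ≡⟨ count-allSeqs-∷ (λ t → ≡-dec _≟F_ t (a ∷ᵥ u)) ⟩
  sum (tabulate occurrencesAfter)                          ≡⟨ sum-tabulate-point occurrencesAfter a occurrencesAfter-≢ ⟩
  occurrencesAfter a                                       ≡⟨ count-≐ _ (λ t → ≡-dec _≟F_ t u) (∷-injectiveʳ , cong (a ∷ᵥ_)) (allSeqs m n) ⟩
  count (λ t → ≡-dec _≟F_ t u) (allSeqs m n)               ≡⟨ count-allSeqs-≡ u ⟩
  1                                                        ∎
  where
  open ≡-Reasoning
  occurrencesAfter : Fin m → ℕ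
  occurrencesAfter c = count (λ t → ≡-dec _≟F_ (c ∷ᵥ t) (a ∷ᵥ u)) (allSeqs m n)
  occurrencesAfter-≢ : ∀ c → c ≢ a → occurrencesAfter c ≡ 0
  occurrencesAfter-≢ c c≢a = count-none _ (λ _ → c≢a ∘ ∷-injectiveˡ) (allSeqs m n)

x⊓[y⊓z]≤z : ∀ x y z → x ⊓ (y ⊓ z) ≤ z
x⊓[y⊓z]≤z x y z = ≤-trans (m⊓n≤n x (y ⊓ z)) (m⊓n≤n y z)

x⊓[y⊓z]≤n⇒z≤n : ∀ {x y z n} → n < x → n < y → x ⊓ (y ⊓ z) ≤ n → z ≤ n
x⊓[y⊓z]≤n⇒z≤n {z = z} {n} n<x n<y x⊓[y⊓z]≤n with z ≤? n
... | yes z≤n′ = z≤n′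
... | no z≰n = contradiction (≤-trans (⊓-glb n<x (⊓-glb n<y (≰⇒> z≰n))) x⊓[y⊓z]≤n) 1+n≰n

[x%d+k]%d≡y : ∀ x k {y d} .{{_ : NonZero d}} → x + k ≡ y + d → y < d → (x % d + k) % d ≡ y
[x%d+k]%d≡y x k {y} {d} x+k≡y+d y<d = begin
  (x % d + k) % d           ≡⟨ %-distribˡ-+ (x % d) k d ⟩
  (x % d % d + k % d) % d   ≡⟨ cong (λ v → (v + k % d) % d) (m%n%n≡m%n x d) ⟩
  (x % d + k % d) % d       ≡⟨ %-distribˡ-+ x k d ⟨
  (x + k) % d               ≡⟨ cong (_% d) x+k≡y+d ⟩
  (y + d) % d               ≡⟨ [m+n]%n≡m%n y d ⟩
  y % d                     ≡⟨ m<n⇒m%n≡m y<d ⟩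
  y                         ∎
  where open ≡-Reasoning

toℕ-mod : ∀ x d .{{_ : NonZero d}} → toℕ (x mod d) ≡ x % d
toℕ-mod x d = toℕ-fromℕ< (m%n<n x d)

lev-refl : (xs : List (Fin m)) → lev xs xs ≡ 0
lev-refl [] = refl
lev-refl (x ∷ xs) with x ≟F x
... | yes _ = n≤0⇒n≡0 (≤-trans (x⊓[y⊓z]≤z _ _ _) (≤-reflexive (trans (+-identityʳ _) (lev-refl xs))))
... | no x≢x = contradiction refl x≢x

lev≡0⇒≡ : (xs ys : List (Fin m)) → lev xs ys ≡ 0 → xs ≡ ys
lev≡0⇒≡ [] [] _ = refl
lev≡0⇒≡ (x ∷ xs) (y ∷ ys) lev≡0 with x ≟F y | x⊓[y⊓z]≤n⇒z≤n (s≤s z≤n) (s≤s z≤n) (≤-reflexive lev≡0)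
... | yes refl | lev+0≤0 = cong (x ∷_) (lev≡0⇒≡ xs ys (n≤0⇒n≡0 (≤-trans (≤-reflexive (sym (+-identityʳ _))) lev+0≤0)))
... | no _ | lev+1≤0 = contradiction (≤-trans (≤-reflexive (+-comm 1 _)) lev+1≤0) λ ()

length≢⇒0<lev : (xs ys : List (Fin m)) → length xs ≢ length ys → 0 < lev xs ys
length≢⇒0<lev xs ys len≢ = n≢0⇒n>0 (len≢ ∘ cong length ∘ lev≡0⇒≡ xs ys)

Hamming≤1 : Vec (Fin m) n → Vec (Fin m) n → Set
Hamming≤1 []ᵥ []ᵥ = ⊤
Hamming≤1 (a ∷ᵥ s) (c ∷ᵥ t) = (a ≡ c × Hamming≤1 s t) ⊎ (a ≢ c × s ≡ t)

hamming≤1? : (s t : Vec (Fin m) n) → Dec (Hamming≤1 s t)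
hamming≤1? []ᵥ []ᵥ = yes tt
hamming≤1? (a ∷ᵥ s) (c ∷ᵥ t) = ((a ≟F c) ×-dec hamming≤1? s t) ⊎-dec (¬? (a ≟F c) ×-dec ≡-dec _≟F_ s t)

length-toList≢suc : (s t : Vec A n) → length (toList s) ≢ suc (length (toList t))
length-toList≢suc s t e = 1+n≢n (trans (sym e) (trans (length-toList s) (sym (length-toList t))))

toList-injective′ : {s t : Vec A n} → toList s ≡ toList t → s ≡ t
toList-injective′ {s = s} {t} eq = trans (sym (cast-is-id refl s)) (toList-injective refl s t eq)

-- Insertion and deletion lead to lists of different lengths, whose distance is positive; so
-- on equal lengths a distance ≤ 1 must come from the substitution branch.
edit≤1⇒Hamming≤1 : (s t : Vec (Fin m) n) → edit s t ≤ 1 → Hamming≤1 s t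
edit≤1⇒Hamming≤1 []ᵥ []ᵥ _ = tt
edit≤1⇒Hamming≤1 (a ∷ᵥ s) (c ∷ᵥ t) edit≤1
  with a ≟F c
     | x⊓[y⊓z]≤n⇒z≤n (s≤s (length≢⇒0<lev (toList s) (c ∷ toList t) (length-toList≢suc s t)))
                     (s≤s (length≢⇒0<lev (a ∷ toList s) (toList t) (length-toList≢suc t s ∘ sym)))
                     edit≤1
... | yes a≡c | lev+0≤1 =
  inj₁ (a≡c , edit≤1⇒Hamming≤1 s t (≤-trans (≤-reflexive (sym (+-identityʳ _))) lev+0≤1))
... | no a≢c | lev+1≤1 =
  inj₂ (a≢c , toList-injective′ (lev≡0⇒≡ _ _ (n≤0⇒n≡0 (+-cancelʳ-≤ 1 _ 0 lev+1≤1))))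

Hamming≤1⇒edit≤1 : (s t : Vec (Fin m) n) → Hamming≤1 s t → edit s t ≤ 1
Hamming≤1⇒edit≤1 []ᵥ []ᵥ _ = z≤n
Hamming≤1⇒edit≤1 (a ∷ᵥ s) (c ∷ᵥ t) s≈t with a ≟F c | s≈t
... | yes _ | inj₁ (_ , s′≈t′) =
  ≤-trans (x⊓[y⊓z]≤z _ _ _) (≤-trans (≤-reflexive (+-identityʳ _)) (Hamming≤1⇒edit≤1 s t s′≈t′))
... | yes a≡c | inj₂ (a≢c , _) = contradiction a≡c a≢c
... | no a≢c | inj₁ (a≡c , _) = contradiction a≡c a≢c
... | no _ | inj₂ (_ , refl) = ≤-trans (x⊓[y⊓z]≤z _ _ _) (≤-reflexive (cong (_+ 1) (lev-refl (toList s))))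

module _ {p : ℕ} where

  private
    Letter : Set
    Letter = Fin (suc p)

  _⊖_ : Letter → Letter → Letter
  y ⊖ c = (toℕ y + (suc p ∸ toℕ c)) mod suc p

  shift-⊖ : (y c : Letter) → shift (y ⊖ c) c ≡ y
  shift-⊖ y c = toℕ-injective (begin
    toℕ (shift (y ⊖ c) c)                               ≡⟨ toℕ-mod (toℕ (y ⊖ c) + toℕ c) (suc p) ⟩
    (toℕ (y ⊖ c) + toℕ c) % suc p                       ≡⟨ cong (λ v → (v + toℕ c) % suc p) (toℕ-mod y′ (suc p)) ⟩
    (y′ % suc p + toℕ c) % suc p                        ≡⟨ [x%d+k]%d≡y y′ (toℕ c) y′+c≡y+m (toℕ<n y) ⟩
    toℕ y                                               ∎)
    where
    open ≡-Reasoning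
    y′ : ℕ
    y′ = toℕ y + (suc p ∸ toℕ c)
    y′+c≡y+m : y′ + toℕ c ≡ toℕ y + suc p
    y′+c≡y+m = trans (+-assoc (toℕ y) _ (toℕ c)) (cong (toℕ y +_) (m∸n+n≡m (<⇒≤ (toℕ<n c))))

  ⊖-shift : (i c : Letter) → shift i c ⊖ c ≡ i
  ⊖-shift i c = toℕ-injective (begin
    toℕ (shift i c ⊖ c)                                 ≡⟨ toℕ-mod (toℕ (shift i c) + (suc p ∸ toℕ c)) (suc p) ⟩
    (toℕ (shift i c) + (suc p ∸ toℕ c)) % suc p         ≡⟨ cong (λ v → (v + (suc p ∸ toℕ c)) % suc p)
                                                                (toℕ-mod (toℕ i + toℕ c) (suc p)) ⟩
    ((toℕ i + toℕ c) % suc p + (suc p ∸ toℕ c)) % suc p ≡⟨ [x%d+k]%d≡y (toℕ i + toℕ c) (suc p ∸ toℕ c) i+c+[m-c]≡i+m (toℕ<n i) ⟩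
    toℕ i                                               ∎)
    where
    open ≡-Reasoning
    i+c+[m-c]≡i+m : toℕ i + toℕ c + (suc p ∸ toℕ c) ≡ toℕ i + suc p
    i+c+[m-c]≡i+m = trans (+-assoc (toℕ i) (toℕ c) _) (cong (toℕ i +_) (m+[n∸m]≡n (<⇒≤ (toℕ<n c))))

  shift-comm : (i c : Letter) → shift i c ≡ shift c i
  shift-comm i c = cong (_mod suc p) (+-comm (toℕ i) (toℕ c))

  shift-injectiveˡ : (i i′ c : Letter) → shift i c ≡ shift i′ c → i ≡ i′
  shift-injectiveˡ i i′ c eq = trans (sym (⊖-shift i c)) (trans (cong (_⊖ c) eq) (⊖-shift i′ c))

  shift-injectiveʳ : (i c c′ : Letter) → shift i c ≡ shift i c′ → c ≡ c′
  shift-injectiveʳ i c c′ eq = shift-injectiveˡ c c′ i (trans (shift-comm c i) (trans eq (shift-comm i c′)))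

  ⊖≡⇔≡shift : {y c i : Letter} → y ⊖ c ≡ i ⇔ y ≡ shift i c
  ⊖≡⇔≡shift {y} {c} = mk⇔ (λ { refl → sym (shift-⊖ y c) }) (λ { refl → ⊖-shift _ c })

  block : Vec Letter (suc k) → Letter
  block {zero} (x ∷ᵥ []ᵥ) = x
  block {suc k} (c ∷ᵥ t) = block t ⊖ c

  ∈B-∷ : {c i : Letter} {t : Vec Letter (suc k)} → (c ∷ᵥ t) ∈S B (suc k) i ⇔ t ∈S B k (shift i c)
  ∈B-∷ {k} {c} {i} {t} = mk⇔ ∈rows⇒ (λ t∈B → ∈-concatMap⁺ row {xs = allFin (suc p)}
                                                (lose (∈-allFin c) (∈-map⁺ (c ∷ᵥ_) t∈B)))
    where
    row : Letter → List (Vec Letter (suc (suc k)))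
    row j = map (j ∷ᵥ_) (B k (shift i j))
    ∈rows⇒ : (c ∷ᵥ t) ∈S concatMap row (allFin (suc p)) → t ∈S B k (shift i c)
    ∈rows⇒ c∷t∈B with satisfied (∈-concatMap⁻ row {xs = allFin (suc p)} c∷t∈B)
    ... | j , c∷t∈row with ∈-map⁻ (j ∷ᵥ_) c∷t∈row
    ...   | u , u∈B , refl = u∈B

  ∈B⇔block≡ : {i : Letter} {t : Vec Letter (suc k)} → t ∈S B k i ⇔ block t ≡ i
  ∈B⇔block≡ {zero} {t = x ∷ᵥ []ᵥ} = mk⇔ (λ { (here e) → ∷-injectiveˡ e ; (there ()) }) (λ { refl → here refl })
  ∈B⇔block≡ {suc k} {i} {c ∷ᵥ t} = ⇔.trans (∈B-∷ {i = i}) (⇔.trans ∈B⇔block≡ (⇔.sym ⊖≡⇔≡shift))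

  neighbourInBlock? : (i : Letter) (s : Vec Letter (suc k)) → Decidable (λ t → Hamming≤1 s t × block t ≡ i)
  neighbourInBlock? i s t = hamming≤1? s t ×-dec (block t ≟F i)

  neighboursInBlock : Letter → Vec Letter (suc k) → ℕ
  neighboursInBlock {k} i s = count (neighbourInBlock? i s) (allSeqs (suc p) (suc k))

  Hamming≤1-singleton : {x c : Letter} → Hamming≤1 (x ∷ᵥ []ᵥ) (c ∷ᵥ []ᵥ)
  Hamming≤1-singleton {x} {c} with x ≟F c
  ... | yes x≡c = inj₁ (x≡c , tt)
  ... | no x≢c = inj₂ (x≢c , refl)

  neighboursInBlock-singleton : (i x : Letter) → neighboursInBlock i (x ∷ᵥ []ᵥ) ≡ 1
  neighboursInBlock-singleton i x = begin
    count P? (allSeqs (suc p) 1)                        ≡⟨ count-allSeqs-∷ P? ⟩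
    sum (tabulate λ c → count (P? ∘ (c ∷ᵥ_)) [ []ᵥ ])  ≡⟨ sum-tabulate-point (λ c → count (P? ∘ (c ∷ᵥ_)) [ []ᵥ ]) i outside ⟩
    count (P? ∘ (i ∷ᵥ_)) [ []ᵥ ]                       ≡⟨ count-singleton (P? ∘ (i ∷ᵥ_)) (Hamming≤1-singleton , refl) ⟩
    1                                                   ∎
    where
    open ≡-Reasoning
    P? : Decidable (λ t → Hamming≤1 (x ∷ᵥ []ᵥ) t × block t ≡ i)
    P? = neighbourInBlock? i (x ∷ᵥ []ᵥ)
    outside : ∀ c → c ≢ i → count (P? ∘ (c ∷ᵥ_)) [ []ᵥ ] ≡ 0
    outside c c≢i = count-none (P? ∘ (c ∷ᵥ_)) (λ { []ᵥ (_ , c≡i) → c≢i c≡i }) [ []ᵥ ]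

  module _ (i a : Letter) (s : Vec Letter (suc k)) where

    neighboursStartingWith : Letter → ℕ
    neighboursStartingWith c = count (neighbourInBlock? i (a ∷ᵥ s) ∘ (c ∷ᵥ_)) (allSeqs (suc p) (suc k))

    neighboursStartingWith-same : neighboursStartingWith a ≡ neighboursInBlock (shift i a) s
    neighboursStartingWith-same =
      count-≐ (neighbourInBlock? i (a ∷ᵥ s) ∘ (a ∷ᵥ_)) (neighbourInBlock? (shift i a) s) (⇒ , ⇐) (allSeqs (suc p) (suc k))
      where
      ⇒ : ∀ {t} → Hamming≤1 (a ∷ᵥ s) (a ∷ᵥ t) × block t ⊖ a ≡ i → Hamming≤1 s t × block t ≡ shift i a
      ⇒ (inj₁ (_ , s≈t) , t∈B) = s≈t , to ⊖≡⇔≡shift t∈B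
      ⇒ (inj₂ (a≢a , _) , _) = contradiction refl a≢a
      ⇐ : ∀ {t} → Hamming≤1 s t × block t ≡ shift i a → Hamming≤1 (a ∷ᵥ s) (a ∷ᵥ t) × block t ⊖ a ≡ i
      ⇐ (s≈t , t∈B) = inj₁ (refl , s≈t) , from ⊖≡⇔≡shift t∈B

    neighboursStartingWith-hit : ∀ {c} → c ≢ a → block s ≡ shift i c → neighboursStartingWith c ≡ 1
    neighboursStartingWith-hit {c} c≢a s∈B = trans
      (count-≐ (neighbourInBlock? i (a ∷ᵥ s) ∘ (c ∷ᵥ_)) (λ t → ≡-dec _≟F_ t s) (⇒ , ⇐) (allSeqs (suc p) (suc k)))
      (count-allSeqs-≡ s)
      where
      ⇒ : ∀ {t} → Hamming≤1 (a ∷ᵥ s) (c ∷ᵥ t) × block t ⊖ c ≡ i → t ≡ s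
      ⇒ (inj₁ (a≡c , _) , _) = contradiction (sym a≡c) c≢a
      ⇒ (inj₂ (_ , s≡t) , _) = sym s≡t
      ⇐ : ∀ {t} → t ≡ s → Hamming≤1 (a ∷ᵥ s) (c ∷ᵥ t) × block t ⊖ c ≡ i
      ⇐ refl = inj₂ (c≢a ∘ sym , refl) , from ⊖≡⇔≡shift s∈B

    neighboursStartingWith-miss : ∀ {c} → c ≢ a → block s ≢ shift i c → neighboursStartingWith c ≡ 0
    neighboursStartingWith-miss {c} c≢a s∉B =
      count-none (neighbourInBlock? i (a ∷ᵥ s) ∘ (c ∷ᵥ_)) excluded (allSeqs (suc p) (suc k))
      where
      excluded : ∀ t → ¬ (Hamming≤1 (a ∷ᵥ s) (c ∷ᵥ t) × block t ⊖ c ≡ i)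
      excluded _ (inj₁ (a≡c , _) , _) = c≢a (sym a≡c)
      excluded _ (inj₂ (_ , refl) , s∈B) = s∉B (to ⊖≡⇔≡shift s∈B)

  neighboursInBlock-own : (i : Letter) (s : Vec Letter (suc k)) → block s ≡ i → neighboursInBlock i s ≡ 1
  neighboursInBlock-own {zero} i (x ∷ᵥ []ᵥ) _ = neighboursInBlock-singleton i x
  neighboursInBlock-own {suc k} i (a ∷ᵥ s) own = begin
    neighboursInBlock i (a ∷ᵥ s)                  ≡⟨ count-allSeqs-∷ (neighbourInBlock? i (a ∷ᵥ s)) ⟩
    sum (tabulate (neighboursStartingWith i a s)) ≡⟨ sum-tabulate-point (neighboursStartingWith i a s) a others ⟩
    neighboursStartingWith i a s a                ≡⟨ neighboursStartingWith-same i a s ⟩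
    neighboursInBlock (shift i a) s               ≡⟨ neighboursInBlock-own (shift i a) s s-own ⟩
    1                                             ∎
    where
    open ≡-Reasoning
    s-own : block s ≡ shift i a
    s-own = to ⊖≡⇔≡shift own
    others : ∀ c → c ≢ a → neighboursStartingWith i a s c ≡ 0
    others c c≢a = neighboursStartingWith-miss i a s c≢a λ s∈Bc →
      c≢a (shift-injectiveʳ i c a (trans (sym s∈Bc) s-own))

  neighboursInBlock-other : (i : Letter) (s : Vec Letter (suc k)) → block s ≢ i → neighboursInBlock i s ≡ suc k
  neighboursInBlock-other {zero} i (x ∷ᵥ []ᵥ) _ = neighboursInBlock-singleton i x
  neighboursInBlock-other {suc k} i (a ∷ᵥ s) other = begin
    neighboursInBlock i (a ∷ᵥ s)                  ≡⟨ count-allSeqs-∷ (neighbourInBlock? i (a ∷ᵥ s)) ⟩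
    sum (tabulate (neighboursStartingWith i a s)) ≡⟨ sum-tabulate-twoPoints (neighboursStartingWith i a s) a≢c₀ others ⟩
    neighboursStartingWith i a s a + neighboursStartingWith i a s c₀
      ≡⟨ cong₂ _+_ (trans (neighboursStartingWith-same i a s) (neighboursInBlock-other (shift i a) s s-other))
                   (neighboursStartingWith-hit i a s (a≢c₀ ∘ sym) s∈Bc₀) ⟩
    suc k + 1                                     ≡⟨ +-comm (suc k) 1 ⟩
    suc (suc k)                                   ∎
    where
    open ≡-Reasoning
    s-other : block s ≢ shift i a
    s-other = other ∘ from ⊖≡⇔≡shift
    c₀ : Letter
    c₀ = block s ⊖ i
    s∈Bc₀ : block s ≡ shift i c₀
    s∈Bc₀ = trans (sym (shift-⊖ (block s) i)) (shift-comm c₀ i)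
    a≢c₀ : a ≢ c₀
    a≢c₀ a≡c₀ = s-other (trans s∈Bc₀ (cong (shift i) (sym a≡c₀)))
    others : ∀ c → c ≢ a → c ≢ c₀ → neighboursStartingWith i a s c ≡ 0
    others c c≢a c≢c₀ = neighboursStartingWith-miss i a s c≢a λ s∈Bc →
      c≢c₀ (shift-injectiveʳ i c c₀ (trans (sym s∈Bc) s∈Bc₀))

  countN1∩B≡neighboursInBlock : (i : Letter) (s : Vec Letter (suc k)) → countN1∩ s (B k i) ≡ neighboursInBlock i s
  countN1∩B≡neighboursInBlock {k} i s =
    count-≐ (λ t → (edit s t ≤? 1) ×-dec (t ∈S? B k i)) (neighbourInBlock? i s) (⇒ , ⇐) (allSeqs (suc p) (suc k))
    where
    ⇒ : ∀ {t} → edit s t ≤ 1 × t ∈S B k i → Hamming≤1 s t × block t ≡ i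
    ⇒ {t} (edit≤1 , t∈B) = edit≤1⇒Hamming≤1 s t edit≤1 , to ∈B⇔block≡ t∈B
    ⇐ : ∀ {t} → Hamming≤1 s t × block t ≡ i → edit s t ≤ 1 × t ∈S B k i
    ⇐ {t} (s≈t , t∈B) = Hamming≤1⇒edit≤1 s t s≈t , from ∈B⇔block≡ t∈B

-- The hypothesis 1 < m only excludes the empty alphabet; the count also holds for m = 1.
lemma11 : (m : ℕ) → 1 < m → (n : ℕ) → (i : Fin m) → (s : Vec (Fin m) (suc n)) →
          (s ∈S B n i → countN1∩ s (B n i) ≡ 1) × (¬ (s ∈S B n i) → countN1∩ s (B n i) ≡ suc n)
lemma11 (suc p) _ n i s =
    (λ s∈B → trans (countN1∩B≡neighboursInBlock i s) (neighboursInBlock-own i s (to ∈B⇔block≡ s∈B)))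
  , (λ s∉B → trans (countN1∩B≡neighboursInBlock i s) (neighboursInBlock-other i s (s∉B ∘ from ∈B⇔block≡)))
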